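{- For every positive integer $n$, the number $G_1(n)$ of complete Gessel words of length $2n$ in which each of the letters $1$ and $\bar{1}$ occurs exactly once (so that each of $2$ and $\bar{2}$ occurs exactly $n-1$ times) is $$G_1(n)=\frac{2n+1}{2}\binom{2n}{n}-2^{2n-1}.$$
   Context: Words are finite sequences over the four-letter alphabet $\{1,2,\bar{1},\bar{2}\}$. For a word $x$ and a letter $\alpha$, $N_\alpha(x)$ denotes the number of occurrences of $\alpha$ in $x$. A word $w$ is a Gessel word if every prefix $x$ of $w$ satisfies $N_2(x)-N_{\bar{2}}(x)\ge 0$ and $N_2(x)+N_1(x)-N_{\bar{2}}(x)-N_{\bar{1}}(x)\ge 0$. A Gessel word $w$ is complete if in addition $N_1(w)=N_{\bar{1}}(w)$ and $N_2(w)=N_{\bar{2}}(w)$. -}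

module Defs where

open import Data.Nat using (ℕ; zero; suc; _+_)
open import Data.Integer using (ℤ; +_; _-_; _≤_) renaming (_+_ to _+ℤ_)
open import Data.List using (List; []; _∷_; length; filter; map; concatMap; inits)
open import Data.List.Relation.Unary.All using (All; all?)
open import Data.Product using (_×_)
open import Relation.Binary.PropositionalEquality using (_≡_)
open import Relation.Nullary using (Dec)
open import Relation.Nullary.Decidable using (_×-dec_)
import Data.Integer.Properties as ℤP
import Data.Nat.Properties as ℕP

data Letter : Set where
  one two one̅ two̅ : Letter

Word : Set
Word = List Letter

N : Letter → Word → ℕ
N α [] = 0
N one  (one  ∷ w) = suc (N one w)
N two  (two  ∷ w) = suc (N two w)
N one̅ (one̅ ∷ w) = suc (N one̅ w)
N two̅ (two̅ ∷ w) = suc (N two̅ w)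
N one  (_ ∷ w) = N one w
N two  (_ ∷ w) = N two w
N one̅ (_ ∷ w) = N one̅ w
N two̅ (_ ∷ w) = N two̅ w

PrefixOK : Word → Set
PrefixOK x = (+ 0 ≤ (+ (N two x)) - (+ (N two̅ x)))
           × (+ 0 ≤ ((+ (N two x)) +ℤ (+ (N one x))) - ((+ (N two̅ x)) +ℤ (+ (N one̅ x))))

prefixOK? : (x : Word) → Dec (PrefixOK x)
prefixOK? x = (+ 0 ℤP.≤? _) ×-dec (+ 0 ℤP.≤? _)

IsGessel : Word → Set
IsGessel w = All PrefixOK (inits w)

IsComplete : Word → Set
IsComplete w = IsGessel w × (N one w ≡ N one̅ w) × (N two w ≡ N two̅ w)

IsG1Word : Word → Set
IsG1Word w = IsComplete w × (N one w ≡ 1) × (N one̅ w ≡ 1)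

isG1Word? : (w : Word) → Dec (IsG1Word w)
isG1Word? w = (all? prefixOK? (inits w) ×-dec ((N one w ℕP.≟ N one̅ w) ×-dec (N two w ℕP.≟ N two̅ w)))
              ×-dec ((N one w ℕP.≟ 1) ×-dec (N one̅ w ℕP.≟ 1))

allWords : ℕ → List Word
allWords zero = [] ∷ []
allWords (suc k) = concatMap (λ a → map (a ∷_) (allWords k)) (one ∷ two ∷ one̅ ∷ two̅ ∷ [])

G₁ : ℕ → ℕ
G₁ n = length (filter isG1Word? (allWords (n + n)))

module Submission where

-- G₁(n) is computed by a transfer-matrix argument.
--
-- Automaton: a word is read letter by letter by an automaton whose state
-- records the two prefix heights N₂ − N₂̄ and N₂ + N₁ − N₂̄ − N₁̄ together with
-- the numbers of 1's and 1̄'s still to be read.  Acceptance coincides with the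
-- Gessel conditions, so G₁(n) = walks (2n) start, where walks k s counts the
-- words of length k accepted from s and satisfies a recursion on the first letter.
--
-- Counts: along the recursion only four families of states occur (neither, only
-- the 1, only the 1̄, or both special letters already read).  Each gets a closed
-- form by induction: ballot numbers once both are read, (h+1)·(K choose u) with
-- one letter pending, and a formula with partial row sums for the start family.

module Automaton where

  open import Defs
  open import Data.Bool using (Bool; true; false; T; if_then_else_)
  open import Data.List using (List; []; _∷_; _++_; map; length; filterᵇ; inits; concatMap)
  open import Data.List.Properties using (length-++; filter-++; filter-≐; filter-none; map-cong)
  open import Data.List.Relation.Unary.All as All using (All; []; _∷_)
  import Data.List.Relation.Unary.All.Properties as All
  open import Data.Maybe using (Maybe; just; nothing; maybe′)
  open import Data.Nat using (ℕ; zero; suc; _+_; _≤_; _<_; z≤n; s≤s; s≤s⁻¹)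
  open import Data.Nat.ListAction using (sum)
  open import Data.Nat.Properties
    using (+-suc; suc-injective; ≤-refl; ≤-reflexive; ≤-trans; n≤1+n; +-monoʳ-≤)
  import Data.Integer as ℤ
  import Data.Integer.Properties as ℤP
  open import Data.Product using (_×_; _,_)
  open import Data.Unit using (tt)
  open import Function using (_∘_; _⇔_; mk⇔; Equivalence)
  open import Relation.Binary.PropositionalEquality
  open import Relation.Nullary using (¬_)
  open import Relation.Nullary.Decidable using (T?)
  open Equivalence using (to; from)

  -- While a word is read, h and g are the current values of N₂ − N₂̄ and of
  -- N₂ + N₁ − N₂̄ − N₁̄, and a, b are the numbers of 1's and 1̄'s still to come.
  data State : Set where
    state : (h g a b : ℕ) → State

  step : Letter → State → Maybe State
  step two  (state h g a b)             = just (state (suc h) (suc g) a b)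
  step two̅ (state (suc h) (suc g) a b) = just (state h g a b)
  step one  (state h g (suc a) b)       = just (state h (suc g) a b)
  step one̅ (state h (suc g) a (suc b)) = just (state h g a b)
  step _    _                           = nothing

  isFinal : State → Bool
  isFinal (state zero _ zero zero) = true
  isFinal _                        = false

  accepts : State → Word → Bool
  accepts s []      = isFinal s
  accepts s (α ∷ w) = maybe′ (λ s′ → accepts s′ w) false (step α s)

  HeightsOK : State → Word → Set
  HeightsOK (state h g _ _) x =
    N two̅ x ≤ h + N two x × N two̅ x + N one̅ x ≤ g + (N two x + N one x)

  Closes : State → Word → Set
  Closes (state h _ a b) w = h + N two w ≡ N two̅ w × N one w ≡ a × N one̅ w ≡ b

  Good : State → Word → Set
  Good s w = All (HeightsOK s) (inits w) × Closes s w

  heights-empty : ∀ s → HeightsOK s []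
  heights-empty (state h g a b) = z≤n , z≤n

  heights-step : ∀ {α s s′} → step α s ≡ just s′ → ∀ x → HeightsOK s (α ∷ x) ⇔ HeightsOK s′ x
  heights-step {two} {state h g a b} refl x =
    mk⇔ (λ (p , q) → ≤-trans p (≤-reflexive (+-suc h _)) , ≤-trans q (≤-reflexive (+-suc g _)))
        (λ (p , q) → ≤-trans p (≤-reflexive (sym (+-suc h _))) , ≤-trans q (≤-reflexive (sym (+-suc g _))))
  heights-step {two̅} {state (suc h) (suc g) a b} refl x =
    mk⇔ (λ (p , q) → s≤s⁻¹ p , s≤s⁻¹ q) (λ (p , q) → s≤s p , s≤s q)
  heights-step {one} {state h g (suc a) b} refl x =
    mk⇔ (λ (p , q) → p , ≤-trans q (≤-reflexive shift))
        (λ (p , q) → p , ≤-trans q (≤-reflexive (sym shift)))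
    where
    shift : g + (N two x + suc (N one x)) ≡ suc g + (N two x + N one x)
    shift = trans (cong (g +_) (+-suc (N two x) _)) (+-suc g _)
  heights-step {one̅} {state h (suc g) a (suc b)} refl x =
    mk⇔ (λ (p , q) → p , s≤s⁻¹ (≤-trans (≤-reflexive (sym shift)) q))
        (λ (p , q) → p , ≤-trans (≤-reflexive shift) (s≤s q))
    where
    shift : N two̅ x + suc (N one̅ x) ≡ suc (N two̅ x + N one̅ x)
    shift = +-suc (N two̅ x) _

  closes-step : ∀ {α s s′} → step α s ≡ just s′ → ∀ w → Closes s (α ∷ w) ⇔ Closes s′ w
  closes-step {two} {state h g a b} refl w =
    mk⇔ (λ (e , e₁ , e₁̅) → trans (sym (+-suc h _)) e , e₁ , e₁̅)
        (λ (e , e₁ , e₁̅) → trans (+-suc h _) e , e₁ , e₁̅)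
  closes-step {two̅} {state (suc h) (suc g) a b} refl w =
    mk⇔ (λ (e , e₁ , e₁̅) → suc-injective e , e₁ , e₁̅) (λ (e , e₁ , e₁̅) → cong suc e , e₁ , e₁̅)
  closes-step {one} {state h g (suc a) b} refl w =
    mk⇔ (λ (e , e₁ , e₁̅) → e , suc-injective e₁ , e₁̅) (λ (e , e₁ , e₁̅) → e , cong suc e₁ , e₁̅)
  closes-step {one̅} {state h (suc g) a (suc b)} refl w =
    mk⇔ (λ (e , e₁ , e₁̅) → e , e₁ , suc-injective e₁̅) (λ (e , e₁ , e₁̅) → e , e₁ , cong suc e₁̅)

  good-step : ∀ {α s s′} → step α s ≡ just s′ → ∀ w → Good s (α ∷ w) ⇔ Good s′ w
  good-step {s = s} e w = mk⇔
    (λ { ((_ ∷ hs) , c) → All.map (λ {x} → to (heights-step e x)) (All.map⁻ hs) , to (closes-step e w) c })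
    (λ (hs , c) → heights-empty s ∷ All.map⁺ (All.map (λ {x} → from (heights-step e x)) hs)
                , from (closes-step e w) c)

  good-stuck : ∀ {α s} → step α s ≡ nothing → ∀ w → ¬ Good s (α ∷ w)
  good-stuck {two̅} {state zero g a b}       _ w ((_ ∷ (() , _) ∷ _) , _)
  good-stuck {two̅} {state (suc h) zero a b} _ w ((_ ∷ (_ , ()) ∷ _) , _)
  good-stuck {one}  {state h g zero b}       _ w (_ , _ , () , _)
  good-stuck {one̅} {state h zero a b}       _ w ((_ ∷ (_ , ()) ∷ _) , _)
  good-stuck {one̅} {state h (suc g) a zero} _ w (_ , _ , _ , ())

  accepts-sound : ∀ s w → T (accepts s w) → Good s w
  accepts-sound s@(state zero g zero zero) [] _ = heights-empty s ∷ [] , refl , refl , refl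
  accepts-sound s (α ∷ w) acc with step α s in e
  ... | just s′ = from (good-step e w) (accepts-sound s′ w acc)

  accepts-complete : ∀ s w → Good s w → T (accepts s w)
  accepts-complete (state zero g zero zero)    [] _                = tt
  accepts-complete (state (suc h) g a b)       [] (_ , () , _)
  accepts-complete (state zero g (suc a) b)    [] (_ , _ , () , _)
  accepts-complete (state zero g zero (suc b)) [] (_ , _ , _ , ())
  accepts-complete s (α ∷ w) good with step α s in e
  ... | just s′ = accepts-complete s′ w (to (good-step e w) good)
  ... | nothing = good-stuck e w good

  letters : List Letter
  letters = one ∷ two ∷ one̅ ∷ two̅ ∷ []

  walks : ℕ → State → ℕ
  walks zero    s = if isFinal s then 1 else 0
  walks (suc k) s = sum (map (λ α → maybe′ (walks k) 0 (step α s)) letters)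

  length-filterᵇ-map : ∀ (p : Word → Bool) (f : Word → Word) ws →
                       length (filterᵇ p (map f ws)) ≡ length (filterᵇ (p ∘ f) ws)
  length-filterᵇ-map p f [] = refl
  length-filterᵇ-map p f (w ∷ ws) with p (f w)
  ... | true  = cong suc (length-filterᵇ-map p f ws)
  ... | false = length-filterᵇ-map p f ws

  length-filterᵇ-extensions : ∀ (p : Word → Bool) ws αs →
    length (filterᵇ p (concatMap (λ α → map (α ∷_) ws) αs))
      ≡ sum (map (λ α → length (filterᵇ (p ∘ (α ∷_)) ws)) αs)
  length-filterᵇ-extensions p ws [] = refl
  length-filterᵇ-extensions p ws (α ∷ αs) = begin
    length (filterᵇ p (map (α ∷_) ws ++ rest))
      ≡⟨ cong length (filter-++ (T? ∘ p) (map (α ∷_) ws) rest) ⟩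
    length (filterᵇ p (map (α ∷_) ws) ++ filterᵇ p rest)
      ≡⟨ length-++ (filterᵇ p (map (α ∷_) ws)) ⟩
    length (filterᵇ p (map (α ∷_) ws)) + length (filterᵇ p rest)
      ≡⟨ cong₂ _+_ (length-filterᵇ-map p (α ∷_) ws) (length-filterᵇ-extensions p ws αs) ⟩
    length (filterᵇ (p ∘ (α ∷_)) ws) + sum (map (λ α → length (filterᵇ (p ∘ (α ∷_)) ws)) αs) ∎
    where
    open ≡-Reasoning
    rest : List Word
    rest = concatMap (λ α → map (α ∷_) ws) αs

  walks-counts : ∀ k s → length (filterᵇ (accepts s) (allWords k)) ≡ walks k s
  walks-counts zero s with isFinal s
  ... | true  = refl
  ... | false = refl
  walks-counts (suc k) s =
    trans (length-filterᵇ-extensions (accepts s) (allWords k) letters)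
          (cong sum (map-cong after-first-letter letters))
    where
    after-first-letter : ∀ α → length (filterᵇ (accepts s ∘ (α ∷_)) (allWords k))
                                 ≡ maybe′ (walks k) 0 (step α s)
    after-first-letter α with step α s
    ... | just s′ = walks-counts k s′
    ... | nothing = cong length (filter-none (T? ∘ λ _ → false) (All.universal (λ _ ()) (allWords k)))

  start : State
  start = state 0 0 1 1

  nonneg-difference : ∀ m n → ℤ.+ 0 ℤ.≤ ℤ.+ m ℤ.- ℤ.+ n ⇔ n ≤ m
  nonneg-difference m n = mk⇔ (ℤP.drop‿+≤+ ∘ ℤP.0≤i-j⇒j≤i) (ℤP.i≤j⇒0≤j-i ∘ ℤ.+≤+)

  prefixOK⇔heightsOK : ∀ x → PrefixOK x ⇔ HeightsOK start x
  prefixOK⇔heightsOK x =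
    mk⇔ (λ (p , q) → to (nonneg-difference _ _) p , to (nonneg-difference _ _) q)
        (λ (p , q) → from (nonneg-difference _ _) p , from (nonneg-difference _ _) q)

  isG1Word⇔accepted : ∀ w → IsG1Word w ⇔ T (accepts start w)
  isG1Word⇔accepted w = mk⇔
    (λ ((gessel , _ , e₂) , e₁ , e₁̅) →
       accepts-complete start w (All.map (λ {x} → to (prefixOK⇔heightsOK x)) gessel , e₂ , e₁ , e₁̅))
    (λ acc → let (heights , e₂ , e₁ , e₁̅) = accepts-sound start w acc in
       (All.map (λ {x} → from (prefixOK⇔heightsOK x)) heights , trans e₁ (sym e₁̅) , e₂) , e₁ , e₁̅)

  G₁≡walks : ∀ n → G₁ n ≡ walks (n + n) start
  G₁≡walks n =
    trans (cong length (filter-≐ isG1Word? (T? ∘ accepts start)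
                          ((λ {w} → to (isG1Word⇔accepted w)) , (λ {w} → from (isG1Word⇔accepted w)))
                          (allWords (n + n))))
          (walks-counts (n + n) start)

  -- An accepted word must bring h down to 0 and place the pending 1's and 1̄'s,
  -- so no word shorter than a + b + h is accepted.
  weight : State → ℕ
  weight (state h _ a b) = a + b + h

  weight-step : ∀ {α s s′} → step α s ≡ just s′ → weight s ≤ suc (weight s′)
  weight-step {two}  {state h g a b}             refl = ≤-trans (+-monoʳ-≤ (a + b) (n≤1+n h)) (n≤1+n _)
  weight-step {two̅} {state (suc h) (suc g) a b} refl = ≤-reflexive (+-suc (a + b) h)
  weight-step {one}  {state h g (suc a) b}       refl = ≤-refl
  weight-step {one̅} {state h (suc g) a (suc b)} refl = ≤-reflexive (cong (_+ h) (+-suc a b))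

  walks-short : ∀ k s → k < weight s → walks k s ≡ 0
  walks-short zero (state (suc h) g a b)       _ = refl
  walks-short zero (state zero g (suc a) b)    _ = refl
  walks-short zero (state zero g zero (suc b)) _ = refl
  walks-short (suc k) s k<w =
    trans (cong sum (map-cong after-first-letter letters)) (sum-zeros letters)
    where
    after-first-letter : ∀ α → maybe′ (walks k) 0 (step α s) ≡ 0
    after-first-letter α with step α s in e
    ... | just s′ = walks-short k s′ (s≤s⁻¹ (≤-trans k<w (weight-step e)))
    ... | nothing = refl
    sum-zeros : ∀ (αs : List Letter) → sum (map (λ _ → 0) αs) ≡ 0
    sum-zeros []       = refl
    sum-zeros (_ ∷ αs) = sum-zeros αs

module Binomials where

  open import Data.Nat as ℕ using (ℕ; zero; suc; _^_; _∸_)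
  import Data.Nat.Properties as ℕ
  open import Data.Nat.Combinatorics using (_C_; nCk+nC[k+1]≡[n+1]C[k+1]; nCk≡nC[n∸k])
  import Data.Nat.Tactic.RingSolver as ℕ-Solver
  open import Data.Integer using (ℤ; +_; _+_; _-_; _*_)
  import Data.Integer.Properties as ℤ
  open import Data.Integer.Tactic.RingSolver using (solve-∀)
  open import Relation.Binary.PropositionalEquality
  open ≡-Reasoning

  -- C⁻ n j = (n choose j − 1).  The shift makes (n choose −1) = 0 an ordinary
  -- value, C⁻ n 0 = 0 holds by computation for every n, and so does Pascal's
  -- rule C⁻ (n+1) (j+1) = C⁻ n (j+1) + C⁻ n j.
  C⁻ : ℕ → ℕ → ℕ
  C⁻ n       zero          = 0
  C⁻ zero    (suc zero)    = 1
  C⁻ zero    (suc (suc j)) = 0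
  C⁻ (suc n) (suc j)       = C⁻ n (suc j) ℕ.+ C⁻ n j

  -- ΣC n j = Σ_{i<j} (n choose i), likewise given by Pascal's rule.
  ΣC : ℕ → ℕ → ℕ
  ΣC n       zero    = 0
  ΣC zero    (suc j) = 1
  ΣC (suc n) (suc j) = ΣC n (suc j) ℕ.+ ΣC n j

  C⁻-binomial : ∀ n j → C⁻ n (suc j) ≡ n C j
  C⁻-binomial zero    zero    = refl
  C⁻-binomial zero    (suc j) = refl
  C⁻-binomial (suc n) zero    = trans (ℕ.+-identityʳ _) (C⁻-binomial n zero)
  C⁻-binomial (suc n) (suc j) = begin
    C⁻ n (suc (suc j)) ℕ.+ C⁻ n (suc j) ≡⟨ cong₂ ℕ._+_ (C⁻-binomial n (suc j)) (C⁻-binomial n j) ⟩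
    n C suc j ℕ.+ n C j                 ≡⟨ ℕ.+-comm (n C suc j) (n C j) ⟩
    n C j ℕ.+ n C suc j                 ≡⟨ nCk+nC[k+1]≡[n+1]C[k+1] n j ⟩
    suc n C suc j                       ∎

  ΣC-step : ∀ n j → ΣC n (suc j) ≡ ΣC n j ℕ.+ C⁻ n (suc j)
  ΣC-step zero    zero    = refl
  ΣC-step zero    (suc j) = refl
  ΣC-step (suc n) zero    = cong (ℕ._+ 0) (ΣC-step n zero)
  ΣC-step (suc n) (suc j) rewrite ΣC-step n (suc j) | ΣC-step n j =
    regroup (ΣC n j) (C⁻ n (suc j)) (C⁻ n (suc (suc j)))
    where
    regroup : ∀ s c c′ → s ℕ.+ c ℕ.+ c′ ℕ.+ (s ℕ.+ c) ≡ s ℕ.+ c ℕ.+ s ℕ.+ (c′ ℕ.+ c)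
    regroup = ℕ-Solver.solve-∀

  central-symmetry : ∀ v → C⁻ (suc (v ℕ.+ v)) (suc (suc v)) ≡ C⁻ (suc (v ℕ.+ v)) (suc v)
  central-symmetry v = begin
    C⁻ (suc (v ℕ.+ v)) (suc (suc v))      ≡⟨ C⁻-binomial _ (suc v) ⟩
    suc (v ℕ.+ v) C suc v                 ≡⟨ cong (_C suc v) row ⟨
    (v ℕ.+ suc v) C suc v                 ≡⟨ nCk≡nC[n∸k] (ℕ.m≤n+m (suc v) v) ⟩
    (v ℕ.+ suc v) C (v ℕ.+ suc v ∸ suc v) ≡⟨ cong ((v ℕ.+ suc v) C_) (ℕ.m+n∸n≡m v (suc v)) ⟩
    (v ℕ.+ suc v) C v                     ≡⟨ cong (_C v) row ⟩
    suc (v ℕ.+ v) C v                     ≡⟨ C⁻-binomial _ v ⟨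
    C⁻ (suc (v ℕ.+ v)) (suc v)            ∎
    where
    row : v ℕ.+ suc v ≡ suc (v ℕ.+ v)
    row = ℕ.+-suc v v

  absorption : ∀ n j → + j * + C⁻ n (suc j) ≡ (+ n - + j + + 1) * + C⁻ n j
  absorption zero    zero          = refl
  absorption zero    (suc zero)    = refl
  absorption zero    (suc (suc j)) =
    trans (ℤ.*-zeroʳ (+ suc (suc j))) (sym (ℤ.*-zeroʳ (+ 0 - + suc (suc j) + + 1)))
  absorption (suc n) zero          = sym (ℤ.*-zeroʳ (+ suc n - + 0 + + 1))
  absorption (suc n) (suc j)       = begin
    (+ 1 + jᶻ) * (a + b)                                    ≡⟨ distribute jᶻ a b ⟩
    (+ 1 + jᶻ) * a + (b + jᶻ * b)
      ≡⟨ cong₂ (λ x y → x + (b + y)) (absorption n (suc j)) (absorption n j) ⟩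
    (nᶻ - (+ 1 + jᶻ) + + 1) * b + (b + (nᶻ - jᶻ + + 1) * c) ≡⟨ collect jᶻ nᶻ b c ⟩
    ((+ 1 + nᶻ) - (+ 1 + jᶻ) + + 1) * (b + c)               ∎
    where
    nᶻ jᶻ a b c : ℤ
    nᶻ = + n
    jᶻ = + j
    a  = + C⁻ n (suc (suc j))
    b  = + C⁻ n (suc j)
    c  = + C⁻ n j
    distribute : ∀ j a b → (+ 1 + j) * (a + b) ≡ (+ 1 + j) * a + (b + j * b)
    distribute = solve-∀
    collect : ∀ j n b c → (n - (+ 1 + j) + + 1) * b + (b + (n - j + + 1) * c)
                          ≡ ((+ 1 + n) - (+ 1 + j) + + 1) * (b + c)
    collect = solve-∀

  absorption′ : ∀ {n} j m → n ≡ j ℕ.+ m → + j * + C⁻ n (suc j) ≡ (+ m + + 1) * + C⁻ n j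
  absorption′ j m refl =
    trans (absorption (j ℕ.+ m) j) (cong (_* + C⁻ (j ℕ.+ m) j) (cancel (+ j) (+ m)))
    where
    cancel : ∀ j m → j + m - j + + 1 ≡ m + + 1
    cancel = solve-∀

  -- Pascal's rule writes the sum for row
  -- 2v+3 as four sums over row 2v+1, which symmetry makes equal.
  half-sum : ∀ v → ΣC (suc (v ℕ.+ v)) (suc v) ≡ 2 ^ (v ℕ.+ v)
  half-sum zero    = refl
  half-sum (suc v) rewrite ℕ.+-suc v v =
    trans (quadruple (ΣC-step r (suc v)) (central-symmetry v) (ΣC-step r v))
          (trans (cong (4 ℕ.*_) (half-sum v)) (four-times (2 ^ (v ℕ.+ v))))
    where
    r : ℕ
    r = suc (v ℕ.+ v)
    quadruple : ∀ {z x y c c′} → z ≡ x ℕ.+ c′ → c′ ≡ c → x ≡ y ℕ.+ c → z ℕ.+ x ℕ.+ (x ℕ.+ y) ≡ 4 ℕ.* x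
    quadruple {y = y} {c} refl refl refl = regroup y c
      where
      regroup : ∀ y c → y ℕ.+ c ℕ.+ c ℕ.+ (y ℕ.+ c) ℕ.+ (y ℕ.+ c ℕ.+ y) ≡ 4 ℕ.* (y ℕ.+ c)
      regroup = ℕ-Solver.solve-∀
    four-times : ∀ x → 4 ℕ.* x ≡ 2 ℕ.* (2 ℕ.* x)
    four-times = ℕ-Solver.solve-∀

  odd-middle : ℕ → ℕ
  odd-middle m = C⁻ (suc (m ℕ.+ m)) (suc m)

  even-row-middle : ∀ m → C⁻ (suc m ℕ.+ suc m) (suc (suc m)) ≡ odd-middle m ℕ.+ odd-middle m
  even-row-middle m rewrite ℕ.+-suc m m = cong (ℕ._+ odd-middle m) (central-symmetry m)

  even-row-half : ∀ m → ΣC (suc m ℕ.+ suc m) m ℕ.+ C⁻ (suc m ℕ.+ suc m) (suc m) ℕ.+ odd-middle m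
                        ≡ 2 ^ suc (m ℕ.+ m)
  even-row-half m rewrite ℕ.+-suc m m = begin
    ΣC (suc r) m ℕ.+ C⁻ (suc r) (suc m) ℕ.+ d ≡⟨ cong (ℕ._+ d) (ΣC-step (suc r) m) ⟨
    ΣC r (suc m) ℕ.+ ΣC r m ℕ.+ d             ≡⟨ ℕ.+-assoc (ΣC r (suc m)) (ΣC r m) d ⟩
    ΣC r (suc m) ℕ.+ (ΣC r m ℕ.+ d)           ≡⟨ cong (ΣC r (suc m) ℕ.+_) (ΣC-step r m) ⟨
    ΣC r (suc m) ℕ.+ ΣC r (suc m)             ≡⟨ cong (λ x → x ℕ.+ x) (half-sum m) ⟩
    2 ^ (m ℕ.+ m) ℕ.+ 2 ^ (m ℕ.+ m)           ≡⟨ cong (2 ^ (m ℕ.+ m) ℕ.+_) (ℕ.+-identityʳ _) ⟨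
    2 ^ suc (m ℕ.+ m)                         ∎
    where
    r d : ℕ
    r = suc (m ℕ.+ m)
    d = odd-middle m

module Counts where

  open Automaton using (State; state; walks; weight; walks-short)
  open Binomials
  open import Data.Nat as ℕ using (ℕ; zero; suc; _^_)
  import Data.Nat.Properties as ℕ
  import Data.Nat.Tactic.RingSolver as ℕ-Solver
  open import Data.Integer using (ℤ; +_; _+_; _-_; _*_)
  import Data.Integer.Properties as ℤ
  open import Data.Integer.Tactic.RingSolver using (solve-∀)
  open import Relation.Binary.PropositionalEquality
  open ≡-Reasoning

  -- The states reached from `start` by a word with nonnegative heights: at first
  -- height h, the second height is fixed by which of 1, 1̄ have been read.
  neither only1 only1̅ both : ℕ → State
  neither h = state h h 1 1
  only1   h = state h (suc h) 0 1
  only1̅  h = state (suc h) h 1 0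
  both    h = state h h 0 0

  both-step₀ : ∀ k → walks (suc k) (both 0) ≡ walks k (both 1)
  both-step₀ k = ℕ.+-identityʳ _

  both-step : ∀ k h → walks (suc k) (both (suc h)) ≡ walks k (both (suc (suc h))) ℕ.+ walks k (both h)
  both-step k h = cong (walks k (both (suc (suc h))) ℕ.+_) (ℕ.+-identityʳ _)

  only1-step₀ : ∀ k → walks (suc k) (only1 0) ≡ walks k (only1 1) ℕ.+ walks k (both 0)
  only1-step₀ k = cong (walks k (only1 1) ℕ.+_) (ℕ.+-identityʳ _)

  only1-step : ∀ k h → walks (suc k) (only1 (suc h))
                       ≡ walks k (only1 (suc (suc h))) ℕ.+ walks k (both (suc h)) ℕ.+ walks k (only1 h)
  only1-step k h = regroup (walks k (only1 (suc (suc h)))) (walks k (both (suc h))) (walks k (only1 h))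
    where
    regroup : ∀ x y z → x ℕ.+ (y ℕ.+ (z ℕ.+ 0)) ≡ x ℕ.+ y ℕ.+ z
    regroup = ℕ-Solver.solve-∀

  only1̅-step₀ : ∀ k → walks (suc k) (only1̅ 0) ≡ walks k (only1̅ 1) ℕ.+ walks k (both 1)
  only1̅-step₀ k = swap (walks k (both 1)) (walks k (only1̅ 1))
    where
    swap : ∀ x y → x ℕ.+ (y ℕ.+ 0) ≡ y ℕ.+ x
    swap = ℕ-Solver.solve-∀

  only1̅-step : ∀ k h → walks (suc k) (only1̅ (suc h))
                        ≡ walks k (only1̅ (suc (suc h))) ℕ.+ walks k (both (suc (suc h))) ℕ.+ walks k (only1̅ h)
  only1̅-step k h = regroup (walks k (both (suc (suc h)))) (walks k (only1̅ (suc (suc h)))) (walks k (only1̅ h))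
    where
    regroup : ∀ x y z → x ℕ.+ (y ℕ.+ (0 ℕ.+ (z ℕ.+ 0))) ≡ y ℕ.+ x ℕ.+ z
    regroup = ℕ-Solver.solve-∀

  neither-step₀ : ∀ k → walks (suc k) (neither 0) ≡ walks k (only1 0) ℕ.+ walks k (neither 1)
  neither-step₀ k = cong (walks k (only1 0) ℕ.+_) (ℕ.+-identityʳ _)

  neither-step : ∀ k h → walks (suc k) (neither (suc h))
                         ≡ walks k (only1 (suc h)) ℕ.+ walks k (neither (suc (suc h)))
                           ℕ.+ walks k (only1̅ h) ℕ.+ walks k (neither h)
  neither-step k h =
    regroup (walks k (only1 (suc h))) (walks k (neither (suc (suc h)))) (walks k (only1̅ h)) (walks k (neither h))
    where
    regroup : ∀ x y z w → x ℕ.+ (y ℕ.+ (z ℕ.+ (w ℕ.+ 0))) ≡ x ℕ.+ y ℕ.+ z ℕ.+ w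
    regroup = ℕ-Solver.solve-∀

  -- The closed forms below are indexed by the height h and by u, the number of
  -- 2 2̄ pairs a remaining word contains beyond the h steps down forced by the
  -- height; the length K is tied to them by an equation.  Reading a 2 uses up
  -- one of the u surplus pairs:
  up-length : ∀ h u → h ℕ.+ (suc u ℕ.+ suc u) ≡ suc (suc h ℕ.+ (u ℕ.+ u))
  up-length = ℕ-Solver.solve-∀

  -- ... and when u = 0, the state reached by a 2 is too high to come back in time.
  unreachable : ∀ {K} h s → K ≡ h ℕ.+ 0 → weight s ≡ suc (suc h) → walks K s ≡ 0
  unreachable h s e w≡ =
    walks-short _ s (subst₂ ℕ._<_ (sym (trans e (ℕ.+-identityʳ h))) (sym w≡) (ℕ.m<n⇒m<1+n (ℕ.n<1+n h)))

  -- Once 1 and 1̄ are both read only 2's and 2̄'s remain: ballot paths, counted by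
  -- the ballot number (K choose u) − (K choose u−1).
  ballot : ℕ → ℕ → ℤ
  ballot K u = + C⁻ K (suc u) - + C⁻ K u

  walks-both : ∀ u h {K} → K ≡ h ℕ.+ (u ℕ.+ u) → + walks K (both h) ≡ ballot K u
  walks-both zero    zero    refl = refl
  walks-both zero    (suc h) {suc K} e = begin
    + walks (suc K) (both (suc h))                      ≡⟨ cong +_ (both-step K h) ⟩
    + walks K (both (suc (suc h))) + + walks K (both h)
      ≡⟨ cong₂ _+_ (cong +_ (unreachable h _ (ℕ.suc-injective e) refl)) (walks-both zero h (ℕ.suc-injective e)) ⟩
    + 0 + ballot K 0                                    ≡⟨ simplify (+ C⁻ K 1) ⟩
    ballot (suc K) 0                                    ∎
    where
    simplify : ∀ c → + 0 + (c - + 0) ≡ (c + + 0) - + 0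
    simplify = solve-∀
  walks-both (suc u) zero    {suc K} e = begin
    + walks (suc K) (both 0) ≡⟨ cong +_ (both-step₀ K) ⟩
    + walks K (both 1)       ≡⟨ walks-both u 1 K≡ ⟩
    ballot K u               ≡⟨ double (+ C⁻ K (suc u)) (+ C⁻ K u) ⟩
    (+ C⁻ K (suc u) + + C⁻ K (suc u)) - (+ C⁻ K (suc u) + + C⁻ K u)
      ≡⟨ cong (λ c → (+ c + + C⁻ K (suc u)) - (+ C⁻ K (suc u) + + C⁻ K u)) (sym middle) ⟩
    ballot (suc K) (suc u)   ∎
    where
    K≡ : K ≡ 1 ℕ.+ (u ℕ.+ u)
    K≡ = ℕ.suc-injective (trans e (up-length 0 u))
    -- a path from height 0 starts with a 2, and the row K = 2u+1 is symmetric
    middle : C⁻ K (suc (suc u)) ≡ C⁻ K (suc u)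
    middle = subst (λ n → C⁻ n (suc (suc u)) ≡ C⁻ n (suc u)) (sym K≡) (central-symmetry u)
    double : ∀ c₁ c₀ → c₁ - c₀ ≡ (c₁ + c₁) - (c₁ + c₀)
    double = solve-∀
  walks-both (suc u) (suc h) {suc K} e = begin
    + walks (suc K) (both (suc h))                      ≡⟨ cong +_ (both-step K h) ⟩
    + walks K (both (suc (suc h))) + + walks K (both h)
      ≡⟨ cong₂ _+_ (walks-both u (suc (suc h)) (ℕ.suc-injective (trans e (up-length (suc h) u))))
                   (walks-both (suc u) h (ℕ.suc-injective e)) ⟩
    ballot K u + ballot K (suc u)
      ≡⟨ telescope (+ C⁻ K (suc (suc u))) (+ C⁻ K (suc u)) (+ C⁻ K u) ⟩
    ballot (suc K) (suc u)                              ∎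
    where
    telescope : ∀ c₂ c₁ c₀ → (c₁ - c₀) + (c₂ - c₁) ≡ (c₂ + c₁) - (c₁ + c₀)
    telescope = solve-∀

  -- With exactly one of 1, 1̄ pending, both families obey recursions of the same
  -- shape (a 2, the pending letter into a ballot state, a 2̄), and the count is
  -- (h+1)·(K choose u).
  pending-base : ∀ H c → + 0 + (c - + 0) + H * c ≡ (+ 1 + H) * (c + + 0)
  pending-base = solve-∀

  pending-edge : ∀ c₁ c₀ → (+ 1 + + 1) * c₀ + (c₁ - c₀) ≡ (+ 1 + + 0) * (c₁ + c₀)
  pending-edge = solve-∀

  pending-inner : ∀ H c₁ c₀ → (+ 3 + H) * c₀ + (c₁ - c₀) + (+ 1 + H) * c₁ ≡ (+ 2 + H) * (c₁ + c₀)
  pending-inner = solve-∀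

  walks-only1 : ∀ u h {K} → K ≡ suc (h ℕ.+ (u ℕ.+ u)) → + walks K (only1 h) ≡ + suc h * + C⁻ K (suc u)
  walks-only1 zero    zero    refl = refl
  walks-only1 zero    (suc h) {suc K} e = begin
    + walks (suc K) (only1 (suc h))
      ≡⟨ cong +_ (only1-step K h) ⟩
    + walks K (only1 (suc (suc h))) + + walks K (both (suc h)) + + walks K (only1 h)
      ≡⟨ cong₂ _+_ (cong₂ _+_ (cong +_ (unreachable (suc h) _ K≡ refl)) (walks-both 0 (suc h) K≡))
                   (walks-only1 0 h K≡) ⟩
    + 0 + ballot K 0 + + suc h * + C⁻ K 1
      ≡⟨ pending-base (+ suc h) (+ C⁻ K 1) ⟩
    + suc (suc h) * + C⁻ (suc K) 1 ∎
    where
    K≡ : K ≡ suc h ℕ.+ 0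
    K≡ = ℕ.suc-injective e
  walks-only1 (suc u) zero    {suc K} e = begin
    + walks (suc K) (only1 0)
      ≡⟨ cong +_ (only1-step₀ K) ⟩
    + walks K (only1 1) + + walks K (both 0)
      ≡⟨ cong₂ _+_ (walks-only1 u 1 (trans (ℕ.suc-injective e) (up-length 0 u)))
                   (walks-both (suc u) 0 (ℕ.suc-injective e)) ⟩
    + 2 * + C⁻ K (suc u) + ballot K (suc u)
      ≡⟨ pending-edge (+ C⁻ K (suc (suc u))) (+ C⁻ K (suc u)) ⟩
    + 1 * + C⁻ (suc K) (suc (suc u)) ∎
  walks-only1 (suc u) (suc h) {suc K} e = begin
    + walks (suc K) (only1 (suc h))
      ≡⟨ cong +_ (only1-step K h) ⟩
    + walks K (only1 (suc (suc h))) + + walks K (both (suc h)) + + walks K (only1 h)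
      ≡⟨ cong₂ _+_ (cong₂ _+_ (walks-only1 u (suc (suc h)) (trans (ℕ.suc-injective e) (cong suc (up-length h u))))
                              (walks-both (suc u) (suc h) (ℕ.suc-injective e)))
                   (walks-only1 (suc u) h (ℕ.suc-injective e)) ⟩
    + suc (suc (suc h)) * + C⁻ K (suc u) + ballot K (suc u) + + suc h * + C⁻ K (suc (suc u))
      ≡⟨ pending-inner (+ h) (+ C⁻ K (suc (suc u))) (+ C⁻ K (suc u)) ⟩
    + suc (suc h) * + C⁻ (suc K) (suc (suc u)) ∎

  walks-only1̅ : ∀ u h {K} → K ≡ suc (suc (h ℕ.+ (u ℕ.+ u))) → + walks K (only1̅ h) ≡ + suc h * + C⁻ K (suc u)
  walks-only1̅ zero    zero    refl = refl
  walks-only1̅ zero    (suc h) {suc K} e = begin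
    + walks (suc K) (only1̅ (suc h))
      ≡⟨ cong +_ (only1̅-step K h) ⟩
    + walks K (only1̅ (suc (suc h))) + + walks K (both (suc (suc h))) + + walks K (only1̅ h)
      ≡⟨ cong₂ _+_ (cong₂ _+_ (cong +_ (unreachable (suc (suc h)) _ K≡ refl)) (walks-both 0 (suc (suc h)) K≡))
                   (walks-only1̅ 0 h K≡) ⟩
    + 0 + ballot K 0 + + suc h * + C⁻ K 1
      ≡⟨ pending-base (+ suc h) (+ C⁻ K 1) ⟩
    + suc (suc h) * + C⁻ (suc K) 1 ∎
    where
    K≡ : K ≡ suc (suc h) ℕ.+ 0
    K≡ = ℕ.suc-injective e
  walks-only1̅ (suc u) zero    {suc K} e = begin
    + walks (suc K) (only1̅ 0)
      ≡⟨ cong +_ (only1̅-step₀ K) ⟩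
    + walks K (only1̅ 1) + + walks K (both 1)
      ≡⟨ cong₂ _+_ (walks-only1̅ u 1 (trans (ℕ.suc-injective e) (cong suc (up-length 0 u))))
                   (walks-both (suc u) 1 (ℕ.suc-injective e)) ⟩
    + 2 * + C⁻ K (suc u) + ballot K (suc u)
      ≡⟨ pending-edge (+ C⁻ K (suc (suc u))) (+ C⁻ K (suc u)) ⟩
    + 1 * + C⁻ (suc K) (suc (suc u)) ∎
  walks-only1̅ (suc u) (suc h) {suc K} e = begin
    + walks (suc K) (only1̅ (suc h))
      ≡⟨ cong +_ (only1̅-step K h) ⟩
    + walks K (only1̅ (suc (suc h))) + + walks K (both (suc (suc h))) + + walks K (only1̅ h)
      ≡⟨ cong₂ _+_ (cong₂ _+_ (walks-only1̅ u (suc (suc h)) (trans (ℕ.suc-injective e) (cong suc (up-length (suc h) u))))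
                              (walks-both (suc u) (suc (suc h)) (ℕ.suc-injective e)))
                   (walks-only1̅ (suc u) h (ℕ.suc-injective e)) ⟩
    + suc (suc (suc h)) * + C⁻ K (suc u) + ballot K (suc u) + + suc h * + C⁻ K (suc (suc u))
      ≡⟨ pending-inner (+ h) (+ C⁻ K (suc (suc u))) (+ C⁻ K (suc u)) ⟩
    + suc (suc h) * + C⁻ (suc K) (suc (suc u)) ∎

  neither-count : ℕ → ℕ → ℕ → ℤ
  neither-count K h u = + suc h * (+ suc h * + C⁻ K (suc u) + + (h ℕ.+ u ℕ.+ 3) * + C⁻ K u - + ΣC K u)

  cancel-difference : ∀ {x y a b : ℤ} → x ≡ y + (a - b) → a ≡ b → x ≡ y
  cancel-difference {y = y} {b = b} x≡ refl =
    trans x≡ (trans (cong (λ z → y + z) (ℤ.+-inverseʳ b)) (ℤ.+-identityʳ y))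

  neither-base : ∀ H c →
    (+ 2 + H) * c + + 0 + (+ 1 + H) * c + (+ 1 + H) * ((+ 1 + H) * c + (H + + 0 + + 3) * + 0 - + 0)
      ≡ (+ 2 + H) * ((+ 2 + H) * (c + + 0) + (+ 1 + H + + 0 + + 3) * + 0 - + 0)
  neither-base = solve-∀

  neither-edge : ∀ U c₂ c₁ c₀ σ₁ σ₀ → σ₁ ≡ σ₀ + c₁ → U * c₁ ≡ (U + + 3 + + 1) * c₀ →
    (+ 1 + + 0) * c₂ + (+ 2) * ((+ 2) * c₁ + (+ 1 + U + + 3) * c₀ - σ₀)
      ≡ (+ 1 + + 0) * ((+ 1 + + 0) * (c₂ + c₁) + (+ 0 + (+ 1 + U) + + 3) * (c₁ + c₀) - (σ₁ + σ₀))
  neither-edge U c₂ c₁ c₀ _ σ₀ refl absorb = cancel-difference (identity U c₂ c₁ c₀ σ₀) (sym absorb)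
    where
    identity : ∀ U c₂ c₁ c₀ σ₀ →
      (+ 1 + + 0) * c₂ + (+ 2) * ((+ 2) * c₁ + (+ 1 + U + + 3) * c₀ - σ₀)
        ≡ (+ 1 + + 0) * ((+ 1 + + 0) * (c₂ + c₁) + (+ 0 + (+ 1 + U) + + 3) * (c₁ + c₀) - ((σ₀ + c₁) + σ₀))
          + ((U + + 3 + + 1) * c₀ - U * c₁)
    identity = solve-∀

  neither-inner : ∀ H U c₂ c₁ c₀ σ₁ σ₀ → σ₁ ≡ σ₀ + c₁ → U * c₁ ≡ (H + U + + 4 + + 1) * c₀ →
    (+ 2 + H) * c₂ + (+ 3 + H) * ((+ 3 + H) * c₁ + (+ 2 + H + U + + 3) * c₀ - σ₀)
      + (+ 1 + H) * c₂ + (+ 1 + H) * ((+ 1 + H) * c₂ + (H + (+ 1 + U) + + 3) * c₁ - σ₁)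
      ≡ (+ 2 + H) * ((+ 2 + H) * (c₂ + c₁) + (+ 1 + H + (+ 1 + U) + + 3) * (c₁ + c₀) - (σ₁ + σ₀))
  neither-inner H U c₂ c₁ c₀ _ σ₀ refl absorb = cancel-difference (identity H U c₂ c₁ c₀ σ₀) (sym absorb)
    where
    identity : ∀ H U c₂ c₁ c₀ σ₀ →
      (+ 2 + H) * c₂ + (+ 3 + H) * ((+ 3 + H) * c₁ + (+ 2 + H + U + + 3) * c₀ - σ₀)
        + (+ 1 + H) * c₂ + (+ 1 + H) * ((+ 1 + H) * c₂ + (H + (+ 1 + U) + + 3) * c₁ - (σ₀ + c₁))
        ≡ (+ 2 + H) * ((+ 2 + H) * (c₂ + c₁) + (+ 1 + H + (+ 1 + U) + + 3) * (c₁ + c₀) - ((σ₀ + c₁) + σ₀))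
          + ((H + U + + 4 + + 1) * c₀ - U * c₁)
    identity = solve-∀

  walks-neither : ∀ u h {K} → K ≡ suc (suc (h ℕ.+ (u ℕ.+ u))) → + walks K (neither h) ≡ neither-count K h u
  walks-neither zero    zero    refl = refl
  walks-neither zero    (suc h) {suc K} e = begin
    + walks (suc K) (neither (suc h))
      ≡⟨ cong +_ (neither-step K h) ⟩
    + walks K (only1 (suc h)) + + walks K (neither (suc (suc h))) + + walks K (only1̅ h) + + walks K (neither h)
      ≡⟨ cong₂ _+_ (cong₂ _+_ (cong₂ _+_ (walks-only1 0 (suc h) K≡)
                                         (cong +_ (unreachable (suc (suc h)) _ K≡ refl)))
                              (walks-only1̅ 0 h K≡))
                   (walks-neither 0 h K≡) ⟩
    + suc (suc h) * + C⁻ K 1 + + 0 + + suc h * + C⁻ K 1 + neither-count K h 0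
      ≡⟨ neither-base (+ h) (+ C⁻ K 1) ⟩
    neither-count (suc K) (suc h) 0 ∎
    where
    K≡ : K ≡ suc (suc h) ℕ.+ 0
    K≡ = ℕ.suc-injective e
  walks-neither (suc u) zero    {suc K} e = begin
    + walks (suc K) (neither 0)
      ≡⟨ cong +_ (neither-step₀ K) ⟩
    + walks K (only1 0) + + walks K (neither 1)
      ≡⟨ cong₂ _+_ (walks-only1 (suc u) 0 (ℕ.suc-injective e))
                   (walks-neither u 1 (trans (ℕ.suc-injective e) (cong suc (up-length 0 u)))) ⟩
    + 1 * + C⁻ K (suc (suc u)) + neither-count K 1 u
      ≡⟨ neither-edge (+ u) (+ C⁻ K (suc (suc u))) (+ C⁻ K (suc u)) (+ C⁻ K u) (+ ΣC K (suc u)) (+ ΣC K u)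
                      (cong +_ (ΣC-step K u)) (absorption′ u (u ℕ.+ 3) K≡) ⟩
    neither-count (suc K) 0 (suc u) ∎
    where
    K≡ : K ≡ u ℕ.+ (u ℕ.+ 3)
    K≡ = trans (ℕ.suc-injective e) (length u)
      where
      length : ∀ u → suc (suc u ℕ.+ suc u) ≡ u ℕ.+ (u ℕ.+ 3)
      length = ℕ-Solver.solve-∀
  walks-neither (suc u) (suc h) {suc K} e = begin
    + walks (suc K) (neither (suc h))
      ≡⟨ cong +_ (neither-step K h) ⟩
    + walks K (only1 (suc h)) + + walks K (neither (suc (suc h))) + + walks K (only1̅ h) + + walks K (neither h)
      ≡⟨ cong₂ _+_ (cong₂ _+_ (cong₂ _+_ (walks-only1 (suc u) (suc h) (ℕ.suc-injective e))
                                         (walks-neither u (suc (suc h))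
                                            (trans (ℕ.suc-injective e) (cong suc (up-length (suc h) u)))))
                              (walks-only1̅ (suc u) h (ℕ.suc-injective e)))
                   (walks-neither (suc u) h (ℕ.suc-injective e)) ⟩
    + suc (suc h) * + C⁻ K (suc (suc u)) + neither-count K (suc (suc h)) u
      + + suc h * + C⁻ K (suc (suc u)) + neither-count K h (suc u)
      ≡⟨ neither-inner (+ h) (+ u) (+ C⁻ K (suc (suc u))) (+ C⁻ K (suc u)) (+ C⁻ K u) (+ ΣC K (suc u)) (+ ΣC K u)
                       (cong +_ (ΣC-step K u)) (absorption′ u (h ℕ.+ u ℕ.+ 4) K≡) ⟩
    neither-count (suc K) (suc h) (suc u) ∎
    where
    K≡ : K ≡ u ℕ.+ (h ℕ.+ u ℕ.+ 4)
    K≡ = trans (ℕ.suc-injective e) (length h u)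
      where
      length : ∀ h u → suc (suc h ℕ.+ (suc u ℕ.+ suc u)) ≡ u ℕ.+ (h ℕ.+ u ℕ.+ 4)
      length = ℕ-Solver.solve-∀

  -- The start family at height 0 and length 2m+2, in terms of d = (2m+1 choose m):
  -- absorption twice, the central entry 2d and the half-row sum give (2m+3)·d − 2^(2m+1).
  central-algebra : ∀ M c c′ c₊ d S T →
    M * c ≡ (+ 2 + M + + 1) * c′ → (+ 1 + M) * c₊ ≡ (+ 1 + M + + 1) * c → c₊ ≡ d + d → T ≡ S + c + d →
    + 1 * (+ 1 * c + (M + + 3) * c′ - S) ≡ (+ 1 + M + (+ 1 + M + + 0) + + 1) * d - T
  central-algebra M c c′ _ d S _ absorb₁ absorb₂ refl refl =
    cancel-difference (cancel-difference (identity M c c′ d S) (sym absorb₁)) (sym absorb₂)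
    where
    identity : ∀ M c c′ d S →
      + 1 * (+ 1 * c + (M + + 3) * c′ - S)
        ≡ (+ 1 + M + (+ 1 + M + + 0) + + 1) * d - (S + c + d)
          + ((+ 1 + M + + 1) * c - (+ 1 + M) * (d + d))
          + ((+ 2 + M + + 1) * c′ - M * c)
    identity = solve-∀

  central-count : ∀ m → neither-count (suc m ℕ.+ suc m) 0 m
                        ≡ + ((2 ℕ.* suc m ℕ.+ 1) ℕ.* odd-middle m) - + 2 ^ suc (m ℕ.+ m)
  central-count m = begin
    neither-count (suc m ℕ.+ suc m) 0 m
      ≡⟨ central-algebra (+ m) _ _ _ (+ odd-middle m) _ _
           (absorption′ m (suc (suc m)) (sym (ℕ.+-suc m (suc m))))
           (absorption′ (suc m) (suc m) refl)
           (cong +_ (even-row-middle m))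
           (cong +_ (sym (even-row-half m))) ⟩
    + (2 ℕ.* suc m ℕ.+ 1) * + odd-middle m - + 2 ^ suc (m ℕ.+ m)
      ≡⟨ cong (_- + 2 ^ suc (m ℕ.+ m)) (ℤ.pos-* (2 ℕ.* suc m ℕ.+ 1) (odd-middle m)) ⟨
    + ((2 ℕ.* suc m ℕ.+ 1) ℕ.* odd-middle m) - + 2 ^ suc (m ℕ.+ m) ∎

open import Defs
open import Data.Nat using (ℕ; suc; _+_; _*_; _^_; _/_; _∸_; _≤_)
open import Data.Nat.Combinatorics using (_C_)
open import Data.Integer using (ℤ; +_; _-_)
open import Relation.Binary.PropositionalEquality using (_≡_)

open import Data.Nat.DivMod using (m*n/n≡m)
open import Data.Nat.Properties using (+-identityʳ; +-suc)
import Data.Nat.Tactic.RingSolver as ℕ-Solver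
open import Relation.Binary.PropositionalEquality using (cong; cong₂; sym; trans; module ≡-Reasoning)
open Automaton using (walks; start; G₁≡walks)
open Binomials using (C⁻-binomial; odd-middle; even-row-middle)
open Counts using (neither-count; walks-neither; central-count)

-- With n = m + 1: G₁(n) = walks (2n) start, which the closed form for the start
-- family evaluates to (2n+1)·(2n−1 choose n−1) − 2^(2n−1); finally
-- (2n choose n) = 2·(2n−1 choose n−1) turns the first term into the stated one.
theorem2p5 : (n : ℕ) → 1 ≤ n →
    + G₁ n ≡ + (((2 * n + 1) * ((2 * n) C n)) / 2) - + (2 ^ (2 * n ∸ 1))
theorem2p5 n@(suc m) _ = begin
  + G₁ n                                        ≡⟨ cong +_ (G₁≡walks n) ⟩
  + walks (n + n) start                         ≡⟨ walks-neither m 0 (cong suc (+-suc m m)) ⟩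
  neither-count (n + n) 0 m                     ≡⟨ central-count m ⟩
  + ((2 * n + 1) * d) - + 2 ^ suc (m + m)       ≡⟨ cong₂ (λ x e → + x - + 2 ^ e) halve exponent ⟨
  + (((2 * n + 1) * ((2 * n) C n)) / 2) - + (2 ^ (2 * n ∸ 1)) ∎
  where
  open ≡-Reasoning
  d : ℕ
  d = odd-middle m
  exponent : 2 * n ∸ 1 ≡ suc (m + m)
  exponent = trans (cong (λ k → m + k) (+-identityʳ n)) (+-suc m m)
  central : (2 * n) C n ≡ d + d
  central = trans (cong (λ k → (n + k) C n) (+-identityʳ n))
                  (trans (sym (C⁻-binomial (n + n) n)) (even-row-middle m))
  halve : (2 * n + 1) * ((2 * n) C n) / 2 ≡ (2 * n + 1) * d
  halve = trans (cong (λ y → (2 * n + 1) * y / 2) central)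
                (trans (cong (_/ 2) (twice (2 * n + 1) d)) (m*n/n≡m ((2 * n + 1) * d) 2))
    where
    twice : ∀ x d → x * (d + d) ≡ x * d * 2
    twice = ℕ-Solver.solve-∀
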